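{- Let $k\ge1$ be an integer and let $\mathcal C$ be a finite set of colors with $|\mathcal C|\ge 3k-1$. Then every minimally $\mathcal C$-inextensible graph has more than $|\mathcal C|-k+1$ vertices and is $(k+1)$-connected.
   Context: All graphs are finite and simple. For a finite set $\mathcal C$ of colors, a proper $\mathcal C$-coloring of a graph $G$ is a map $f:V(G)\to\mathcal C$ with $f(u)\ne f(v)$ for adjacent $u,v$. A $\mathcal C$-template on $G$ is a triple $T=(S,c,F)$ where $S\subset V(G)$, $c:S\to\mathcal C$ is a proper $\mathcal C$-coloring of $G[S]$, and $F$ assigns to each $v\in V(G)\setminus S$ a subset $F(v)\subset\mathcal C$. For the fixed integer $k$, $\mathrm{cost}(T)=k|S|+\sum_{v\in V(G)\setminus S}|F(v)|$. A proper $\mathcal C$-coloring $f$ of $G$ respects $T$ if $f|_S=c$ and $f(v)\notin F(v)$ for all $v\in V(G)\setminus S$. $G$ is $\mathcal C$-inextensible if there is a $\mathcal C$-template $T=(S,c,F)$ on $G$ with $\mathrm{cost}(T)<2k^2$, $|F(v)|\le k$ for all $v\in V(G)\setminus S$, and no proper $\mathcal C$-coloring of $G$ respecting $T$; otherwise $G$ is $\mathcal C$-extensible. $G$ is minimally $\mathcal C$-inextensible if it is $\mathcal C$-inextensible while every induced subgraph of $G$ with fewer vertices than $G$ is $\mathcal C$-extensible. A cutset of $G$ is a (possibly empty) set of vertices whose removal leaves a disconnected graph; $G$ is $m$-connected if it has more than $m$ vertices and no cutset of size less than $m$. -}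

module Defs where

open import Data.Nat using (ℕ; zero; suc; _+_; _*_; _∸_; _≤_; _<_)
open import Data.Bool using (Bool; true; false)
open import Data.Fin using (Fin)
open import Data.Fin.Subset using (Subset; _∈_; _∉_; ∣_∣)
open import Data.Fin.Subset.Properties using (_∈?_)
open import Data.List using (map; allFin)
open import Data.Nat.ListAction using (sum)
open import Data.Product using (Σ; _×_; ∃)
open import Relation.Nullary using (¬_; yes; no)
open import Relation.Binary.PropositionalEquality using (_≡_; _≢_)
open import Function.Definitions using (Injective)

record Graph (n : ℕ) : Set where
  field
    adj   : Fin n → Fin n → Bool
    sym   : ∀ u v → adj u v ≡ adj v u
    irrefl : ∀ v → adj v v ≡ false

open Graph public

Adjacent : ∀ {n} → Graph n → Fin n → Fin n → Set
Adjacent G u v = adj G u v ≡ true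

-- Induced subgraph of G on the image of an injective map ι : Fin n' → Fin n
-- (isomorphic copy of G[ι(Fin n')]).
induced : ∀ {n n'} (G : Graph n) (ι : Fin n' → Fin n) → Graph n'
induced G ι = record
  { adj = λ u v → adj G (ι u) (ι v)
  ; sym = λ u v → sym G (ι u) (ι v)
  ; irrefl = λ v → irrefl G (ι v) }

Proper : ∀ {n} (m : ℕ) → Graph n → (Fin n → Fin m) → Set
Proper m G f = ∀ u v → Adjacent G u v → f u ≢ f v

-- A 𝒞-template (S , c , F).  c is only relevant on S and F only outside S.
record Template {n : ℕ} (m : ℕ) (G : Graph n) : Set where
  field
    S : Subset n
    c : Fin n → Fin m
    c-proper : ∀ u v → u ∈ S → v ∈ S → Adjacent G u v → c u ≢ c v
    F : Fin n → Subset m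

open Template public

cost : ∀ {n m} {G : Graph n} → ℕ → Template m G → ℕ
cost {n} k T = k * ∣ S T ∣ + sum (map term (allFin n))
  where
  term : Fin _ → ℕ
  term v with v ∈? S T
  ... | yes _ = 0
  ... | no  _ = ∣ F T v ∣

Respects : ∀ {n m} {G : Graph n} → Template m G → (Fin n → Fin m) → Set
Respects T f = (∀ v → v ∈ S T → f v ≡ c T v) × (∀ v → v ∉ S T → f v ∉ F T v)

Inextensible : ∀ {n} (k m : ℕ) → Graph n → Set
Inextensible k m G = Σ (Template m G) λ T →
  (cost k T < 2 * (k * k)) ×
  (∀ v → v ∉ S T → ∣ F T v ∣ ≤ k) ×
  ¬ (Σ (Fin _ → Fin m) λ f → Proper m G f × Respects T f)

Extensible : ∀ {n} (k m : ℕ) → Graph n → Set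
Extensible k m G = ¬ Inextensible k m G

MinimallyInextensible : ∀ {n} (k m : ℕ) → Graph n → Set
MinimallyInextensible {n} k m G =
  Inextensible k m G ×
  (∀ n' (ι : Fin n' → Fin n) → Injective _≡_ _≡_ ι → n' < n →
     Extensible k m (induced G ι))

data Reach {n} (G : Graph n) (X : Subset n) (u : Fin n) : Fin n → Set where
  here : Reach G X u u
  step : ∀ {v w} → Reach G X u v → Adjacent G v w → w ∉ X → Reach G X u w

ConnectedWithout : ∀ {n} → Graph n → Subset n → Set
ConnectedWithout G X = ∀ u v → u ∉ X → v ∉ X → Reach G X u v

IsCutset : ∀ {n} → Graph n → Subset n → Set
IsCutset G X = ¬ ConnectedWithout G X

Connected : ∀ {n} → ℕ → Graph n → Set
Connected {n} r G = r < n × (∀ X → ∣ X ∣ < r → ¬ IsCutset G X)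

-- Fix a template (S, c, F) with no respecting colouring. By minimality every template of cost
-- below 2k² on a proper subset of the vertices extends. Deleting one vertex y outside S and
-- colouring the rest shows |F(y)| + deg y ≥ m, so |F(y)| + n > m. If some such |F(y)| is
-- below k this gives n > m - k + 1; otherwise every vertex costs at least k, so nk < 2k²,
-- while |F(y)| ≤ k and 3k ≤ m + 1 give n ≥ 2k.
--
-- Let X, |X| ≤ k, separate sides A and B. If both sides meet the complement of S, let A be
-- the cheaper one, so cost(A) < k²: colour G minus A \ S, then recolour A ∪ X with X
-- precoloured by that colouring (cost < k² + k|X| ≤ 2k²) and glue. If A ⊆ S, colour G - A,
-- letting each vertex of X also forbid the colours of its neighbours in A, or precolouring
-- it from a colouring of G minus B \ S when its list would exceed k; the extra cost is at
-- most |X||A| ≤ k|A| = cost(A). If X contains every vertex outside S, summing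
-- |F(y)| + n > m over those t ≤ k vertices contradicts the cost bound.

module Submission where

open import Defs renaming (sym to adj-sym)
open import Data.Nat using (ℕ; zero; suc; _+_; _*_; _∸_; _≤_; _<_; z≤n; s≤s; _<ᵇ_; >-nonZero)
open import Data.Nat.Properties hiding (suc-injective; _≟_)
open import Data.Bool using (Bool; true; false; if_then_else_; not; _∨_; _∧_; T)
open import Data.Bool.Properties using (∧-zeroʳ; ∨-zeroʳ; ∨-identityʳ; ∨-conicalˡ; ∨-conicalʳ; ∧-conicalˡ; ¬-not)
import Data.Bool.Properties as Bool
open import Data.Fin using (Fin; zero; suc)
open import Data.Fin.Properties using (suc-injective; sequence; _≟_; any?)
open import Data.Vec using ([]; _∷_; lookup)
import Data.Vec as Vec
open import Data.Vec.Properties using ([]=⇒lookup; lookup⇒[]=; lookup∘tabulate)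
open import Data.Fin.Subset using (Subset; _∈_; _∉_; ∣_∣; _∪_; ⁅_⁆) renaming (⊥ to ∅)
open import Data.Fin.Subset.Properties using (_∈?_; x∈p∪q⁺; x∈⁅x⁆; ∣⁅x⁆∣≡1; ∣⊥∣≡0; drop-there)
open import Data.List using (map; allFin; tabulate)
open import Data.List.Properties using (map-tabulate)
import Data.Nat.ListAction as List
open import Data.Nat.Solver using (module +-*-Solver)
open import Algebra.Properties.Semiring.Sum +-*-semiring using (sum; ∑-distrib-+; sum-cong-≗; *-distribʳ-sum)
open import Data.Product using (Σ; ∃; _,_; proj₁; proj₂; _×_)
open import Data.Sum using (_⊎_; inj₁; inj₂; [_,_]′)
open import Function.Base using (_∘_; id; const)
open import Function.Definitions using (Injective)
open import Relation.Binary.PropositionalEquality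
open import Relation.Nullary using (¬_; Dec; does; yes; no; contradiction)
open import Relation.Nullary.Decidable using (¬¬-excluded-middle; _×-dec_)
open import Relation.Nullary.Negation using (¬¬-Monad)
open import Effect.Monad using (RawMonad)
open import Data.Empty using (⊥; ⊥-elim)

∨-true : ∀ a {b} → a ∨ b ≡ true → a ≡ true ⊎ b ≡ true
∨-true true  _  = inj₁ refl
∨-true false eq = inj₂ eq

exclusive-sym : ∀ {a b : Bool} → (a ≡ true → b ≡ false) → b ≡ true → a ≡ false
exclusive-sym {false} _    _    = refl
exclusive-sym {true}  a⇒¬b refl with () ← a⇒¬b refl

-- Finite sums over vertex sets

sumOn : ∀ {n} → (Fin n → Bool) → (Fin n → ℕ) → ℕ
sumOn W h = sum λ v → if W v then h v else 0

count : ∀ {n} → (Fin n → Bool) → ℕ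
count W = sumOn W (const 1)

sum-mono-≤ : ∀ {n} {f g : Fin n → ℕ} → (∀ v → f v ≤ g v) → sum f ≤ sum g
sum-mono-≤ {zero}  f≤g = z≤n
sum-mono-≤ {suc n} f≤g = +-mono-≤ (f≤g zero) (sum-mono-≤ (f≤g ∘ suc))

sum-const : ∀ n a → sum {n} (const a) ≡ n * a
sum-const zero    a = refl
sum-const (suc n) a = cong (a +_) (sum-const n a)

sum-point : ∀ {n} (f : Fin n → ℕ) v → f v ≤ sum f
sum-point f zero    = m≤m+n (f zero) _
sum-point f (suc v) = ≤-trans (sum-point (f ∘ suc) v) (m≤n+m _ (f zero))

sumOn-mono-⊆ : ∀ {n} {V W : Fin n → Bool} (h : Fin n → ℕ) → (∀ v → V v ≡ true → W v ≡ true) → sumOn V h ≤ sumOn W h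
sumOn-mono-⊆ {V = V} {W} h V⊆W = sum-mono-≤ pointwise
  where
  pointwise : ∀ v → (if V v then h v else 0) ≤ (if W v then h v else 0)
  pointwise v with V v in eq
  ... | true rewrite V⊆W v eq = ≤-refl
  ... | false = z≤n

sumOn-≤-sum : ∀ {n} (W : Fin n → Bool) (h : Fin n → ℕ) → sumOn W h ≤ sum h
sumOn-≤-sum W h = sumOn-mono-⊆ h λ _ _ → refl

sumOn-mono-≤ : ∀ {n} (W : Fin n → Bool) {f g : Fin n → ℕ} → (∀ v → W v ≡ true → f v ≤ g v) → sumOn W f ≤ sumOn W g
sumOn-mono-≤ W {f} {g} f≤g = sum-mono-≤ pointwise
  where
  pointwise : ∀ v → (if W v then f v else 0) ≤ (if W v then g v else 0)
  pointwise v with W v in eq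
  ... | true  = f≤g v eq
  ... | false = z≤n

sumOn-cong : ∀ {n} (W : Fin n → Bool) {f g : Fin n → ℕ} → (∀ v → W v ≡ true → f v ≡ g v) → sumOn W f ≡ sumOn W g
sumOn-cong W {f} {g} f≡g = sum-cong-≗ pointwise
  where
  pointwise : ∀ v → (if W v then f v else 0) ≡ (if W v then g v else 0)
  pointwise v with W v in eq
  ... | true  = f≡g v eq
  ... | false = refl

sumOn-+ : ∀ {n} (W : Fin n → Bool) (f g : Fin n → ℕ) → sumOn W (λ v → f v + g v) ≡ sumOn W f + sumOn W g
sumOn-+ W f g = trans (sum-cong-≗ λ v → lemma (W v))
                      (∑-distrib-+ (λ v → if W v then f v else 0) (λ v → if W v then g v else 0))
  where
  lemma : ∀ {v} b → (if b then f v + g v else 0) ≡ (if b then f v else 0) + (if b then g v else 0)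
  lemma true  = refl
  lemma false = refl

sumOn-const : ∀ {n} (W : Fin n → Bool) a → sumOn W (const a) ≡ count W * a
sumOn-const W a = trans (sum-cong-≗ λ v → lemma (W v)) (sym (*-distribʳ-sum a (λ v → if W v then 1 else 0)))
  where
  lemma : ∀ b → (if b then a else 0) ≡ (if b then 1 else 0) * a
  lemma true  = sym (+-identityʳ a)
  lemma false = refl

sum-split : ∀ {n} (W : Fin n → Bool) (h : Fin n → ℕ) → sum h ≡ sumOn W h + sumOn (not ∘ W) h
sum-split W h = trans (sum-cong-≗ λ v → lemma (W v))
                      (∑-distrib-+ (λ v → if W v then h v else 0) (λ v → if not (W v) then h v else 0))
  where
  lemma : ∀ {a} b → a ≡ (if b then a else 0) + (if not b then a else 0)
  lemma true  = sym (+-identityʳ _)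
  lemma false = refl

sumOn-disjoint : ∀ {n} (L R : Fin n → Bool) (h : Fin n → ℕ) → (∀ v → L v ≡ true → R v ≡ false) →
                 sumOn L h + sumOn R h ≤ sum h
sumOn-disjoint L R h disjoint = begin
  sumOn L h + sumOn R h ≡⟨ ∑-distrib-+ (λ v → if L v then h v else 0) (λ v → if R v then h v else 0) ⟨
  sum (λ v → (if L v then h v else 0) + (if R v then h v else 0)) ≤⟨ sum-mono-≤ pointwise ⟩
  sum h ∎
  where
  open ≤-Reasoning
  pointwise : ∀ v → (if L v then h v else 0) + (if R v then h v else 0) ≤ h v
  pointwise v with L v in eq
  ... | true rewrite disjoint v eq = ≤-reflexive (+-identityʳ (h v))
  ... | false with R v
  ...   | true  = ≤-refl
  ...   | false = z≤n

0<count : ∀ {n} (W : Fin n → Bool) v → W v ≡ true → 0 < count W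
0<count W v eq = ≤-trans (≤-reflexive (cong (λ b → if b then 1 else 0) (sym eq))) (sum-point (λ v → if W v then 1 else 0) v)

n≡count+count∁ : ∀ {n} (W : Fin n → Bool) → n ≡ count W + count (not ∘ W)
n≡count+count∁ {n} W = trans (sym (trans (sum-const n 1) (*-identityʳ n))) (sum-split W (const 1))

count≤n : ∀ {n} (W : Fin n → Bool) → count W ≤ n
count≤n {n} W = ≤-trans (sumOn-≤-sum W (const 1)) (≤-reflexive (trans (sum-const n 1) (*-identityʳ n)))

count<n : ∀ {n} (W : Fin n → Bool) v → W v ≡ false → count W < n
count<n {suc n} W zero    e rewrite e = s≤s (count≤n (W ∘ suc))
count<n {suc n} W (suc v) e with W zero
... | true  = s≤s (count<n (W ∘ suc) v e)
... | false = m<n⇒m<1+n (count<n (W ∘ suc) v e)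

sum-tabulate : ∀ {n} (f : Fin n → ℕ) → List.sum (tabulate f) ≡ sum f
sum-tabulate {zero}  f = refl
sum-tabulate {suc n} f = cong (f zero +_) (sum-tabulate (f ∘ suc))

sum-allFin : ∀ {n} (f : Fin n → ℕ) → List.sum (map f (allFin n)) ≡ sum f
sum-allFin {n} f = trans (cong List.sum (map-tabulate id f)) (sum-tabulate f)

∈⇒true : ∀ {n} {p : Subset n} {v} → v ∈ p → lookup p v ≡ true
∈⇒true = []=⇒lookup

true⇒∈ : ∀ {n} {p : Subset n} {v} → lookup p v ≡ true → v ∈ p
true⇒∈ {p = p} {v} = lookup⇒[]= v p

∉⇒false : ∀ {n} {p : Subset n} {v} → v ∉ p → lookup p v ≡ false
∉⇒false {p = p} {v} v∉p with lookup p v in eq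
... | true  = contradiction (true⇒∈ eq) v∉p
... | false = refl

false⇒∉ : ∀ {n} {p : Subset n} {v} → lookup p v ≡ false → v ∉ p
false⇒∉ eq v∈p with () ← trans (sym (∈⇒true v∈p)) eq

∣p∣≡count : ∀ {n} (p : Subset n) → ∣ p ∣ ≡ count (lookup p)
∣p∣≡count []          = refl
∣p∣≡count (true ∷ p)  = cong suc (∣p∣≡count p)
∣p∣≡count (false ∷ p) = ∣p∣≡count p

∣p∪q∣≤∣p∣+∣q∣ : ∀ {n} (p q : Subset n) → ∣ p ∪ q ∣ ≤ ∣ p ∣ + ∣ q ∣
∣p∪q∣≤∣p∣+∣q∣ []          []          = z≤n
∣p∪q∣≤∣p∣+∣q∣ (true ∷ p)  (true ∷ q)  = s≤s (≤-trans (∣p∪q∣≤∣p∣+∣q∣ p q) (+-monoʳ-≤ ∣ p ∣ (n≤1+n ∣ q ∣)))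
∣p∪q∣≤∣p∣+∣q∣ (true ∷ p)  (false ∷ q) = s≤s (∣p∪q∣≤∣p∣+∣q∣ p q)
∣p∪q∣≤∣p∣+∣q∣ (false ∷ p) (true ∷ q)  = ≤-trans (s≤s (∣p∪q∣≤∣p∣+∣q∣ p q)) (≤-reflexive (sym (+-suc ∣ p ∣ ∣ q ∣)))
∣p∪q∣≤∣p∣+∣q∣ (false ∷ p) (false ∷ q) = ∣p∪q∣≤∣p∣+∣q∣ p q

∣p∣<n⇒∃∉ : ∀ {n} (p : Subset n) → ∣ p ∣ < n → ∃ λ x → x ∉ p
∣p∣<n⇒∃∉ (false ∷ p) _ = zero , λ ()
∣p∣<n⇒∃∉ (true ∷ p) (s≤s ∣p∣<n) with ∣p∣<n⇒∃∉ p ∣p∣<n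
... | x , x∉p = suc x , x∉p ∘ drop-there

imageOn : ∀ {m n} → (Fin n → Bool) → (Fin n → Fin m) → Subset m
imageOn {n = zero}  W f = ∅
imageOn {n = suc n} W f = (if W zero then ⁅ f zero ⁆ else ∅) ∪ imageOn (W ∘ suc) (f ∘ suc)

imageOn-∈ : ∀ {m n} (W : Fin n → Bool) (f : Fin n → Fin m) u → W u ≡ true → f u ∈ imageOn W f
imageOn-∈ W f zero    eq rewrite eq = x∈p∪q⁺ (inj₁ (x∈⁅x⁆ (f zero)))
imageOn-∈ W f (suc u) eq = x∈p∪q⁺ (inj₂ (imageOn-∈ (W ∘ suc) (f ∘ suc) u eq))

∣imageOn∣≤count : ∀ {m n} (W : Fin n → Bool) (f : Fin n → Fin m) → ∣ imageOn W f ∣ ≤ count W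
∣imageOn∣≤count {m} {zero}  W f = ≤-reflexive (∣⊥∣≡0 m)
∣imageOn∣≤count {m} {suc n} W f =
  ≤-trans (∣p∪q∣≤∣p∣+∣q∣ (if W zero then ⁅ f zero ⁆ else ∅) (imageOn (W ∘ suc) (f ∘ suc)))
          (+-mono-≤ (head (W zero)) (∣imageOn∣≤count (W ∘ suc) (f ∘ suc)))
  where
  head : ∀ b → ∣ (if b then ⁅ f zero ⁆ else ∅) ∣ ≤ (if b then 1 else 0)
  head true  = ≤-reflexive (∣⁅x⁆∣≡1 (f zero))
  head false = ≤-reflexive (∣⊥∣≡0 m)

colour-avoiding : ∀ {m n} (A : Subset m) (W : Fin n → Bool) (f : Fin n → Fin m) → ∣ A ∣ + count W < m →
                  ∃ λ x → x ∉ A × (∀ u → W u ≡ true → f u ≢ x)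
colour-avoiding A W f small with ∣p∣<n⇒∃∉ (A ∪ imageOn W f)
  (≤-<-trans (≤-trans (∣p∪q∣≤∣p∣+∣q∣ A (imageOn W f)) (+-monoʳ-≤ ∣ A ∣ (∣imageOn∣≤count W f))) small)
... | x , x∉ = x , x∉ ∘ x∈p∪q⁺ ∘ inj₁ ,
               λ u u∈ fu≡x → x∉ (x∈p∪q⁺ (inj₂ (subst (_∈ imageOn W f) fu≡x (imageOn-∈ W f u u∈))))

consIndex : ∀ {n j} b → (Fin j → Fin n) → Fin ((if b then 1 else 0) + j) → Fin (suc n)
consIndex true  ι zero    = zero
consIndex true  ι (suc i) = suc (ι i)
consIndex false ι i       = suc (ι i)

index : ∀ {n} (W : Fin n → Bool) → Fin (count W) → Fin n
index {suc n} W = consIndex (W zero) (index (W ∘ suc))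

index-injective : ∀ {n} (W : Fin n → Bool) → Injective _≡_ _≡_ (index W)
index-injective {suc n} W = consIndex-injective (W zero) (index-injective (W ∘ suc))
  where
  consIndex-injective : ∀ {j} {ι : Fin j → Fin n} b → Injective _≡_ _≡_ ι → Injective _≡_ _≡_ (consIndex b ι)
  consIndex-injective true  inj {zero}  {zero}  _  = refl
  consIndex-injective true  inj {suc i} {suc j} eq = cong suc (inj (suc-injective eq))
  consIndex-injective false inj eq = inj (suc-injective eq)

index-∈ : ∀ {n} (W : Fin n → Bool) i → W (index W i) ≡ true
index-∈ {suc n} W = consIndex-∈ (W zero) refl (index-∈ (W ∘ suc))
  where
  consIndex-∈ : ∀ {j} {ι : Fin j → Fin n} b → W zero ≡ b → (∀ i → W (suc (ι i)) ≡ true) →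
                ∀ i → W (consIndex b ι i) ≡ true
  consIndex-∈ true  eq ι∈ zero    = eq
  consIndex-∈ true  eq ι∈ (suc i) = ι∈ i
  consIndex-∈ false eq ι∈ i       = ι∈ i

index-preimage : ∀ {n} (W : Fin n → Bool) v → W v ≡ true → ∃ λ i → index W i ≡ v
index-preimage {suc n} W zero    eq = zero-preimage (W zero) eq
  where
  zero-preimage : ∀ {j} {ι : Fin j → Fin n} b → b ≡ true → ∃ λ i → consIndex b ι i ≡ zero
  zero-preimage true refl = zero , refl
index-preimage {suc n} W (suc v) eq with index-preimage (W ∘ suc) v eq
... | i , refl = suc-preimage (W zero)
  where
  suc-preimage : ∀ b → ∃ λ i′ → consIndex b (index (W ∘ suc)) i′ ≡ suc (index (W ∘ suc) i)
  suc-preimage true  = suc i , refl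
  suc-preimage false = i , refl

sum-index : ∀ {n} (W : Fin n → Bool) (h : Fin n → ℕ) → sum (h ∘ index W) ≡ sumOn W h
sum-index {zero}  W h = refl
sum-index {suc n} W h = trans (sum-consIndex (W zero)) (cong ((if W zero then h zero else 0) +_) (sum-index (W ∘ suc) (h ∘ suc)))
  where
  sum-consIndex : ∀ b → sum (h ∘ consIndex b (index (W ∘ suc))) ≡
                        (if b then h zero else 0) + sum (h ∘ suc ∘ index (W ∘ suc))
  sum-consIndex true  = refl
  sum-consIndex false = refl

-- pullback goes through an explicit equation W v ≡ b so that pullback-index can case on
-- W (index W i); a with-abstraction over it would be ill-typed.
pullbackCase : ∀ {n} {A : Set} (W : Fin n → Bool) → (Fin (count W) → A) → (Fin n → A) →
               ∀ v b → W v ≡ b → A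
pullbackCase W f default v true  eq = f (proj₁ (index-preimage W v eq))
pullbackCase W f default v false _  = default v

pullback : ∀ {n} {A : Set} (W : Fin n → Bool) → (Fin (count W) → A) → (Fin n → A) → Fin n → A
pullback W f default v = pullbackCase W f default v (W v) refl

pullback-index : ∀ {n} {A : Set} (W : Fin n → Bool) (f : Fin (count W) → A) default i →
                 pullback W f default (index W i) ≡ f i
pullback-index W f default i = case-index (W (index W i)) refl
  where
  case-index : ∀ b (eq : W (index W i) ≡ b) → pullbackCase W f default (index W i) b eq ≡ f i
  case-index true  eq = cong f (index-injective W (proj₂ (index-preimage W (index W i) eq)))
  case-index false eq with () ← trans (sym (index-∈ W i)) eq

-- A template on a vertex subset: pre marks S, col is c and forb is F.
record Demands (m n : ℕ) : Set where
  field
    pre  : Fin n → Bool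
    col  : Fin n → Fin m
    forb : Fin n → Subset m

open Demands

Fits : ∀ {m n} → Demands m n → Fin n → Fin m → Set
Fits D v x = (pre D v ≡ true → x ≡ col D v) × (pre D v ≡ false → x ∉ forb D v)

ProperOn : ∀ {m n} → Graph n → (Fin n → Bool) → (Fin n → Fin m) → Set
ProperOn G W f = ∀ u v → W u ≡ true → W v ≡ true → Adjacent G u v → f u ≢ f v

Extendable : ∀ {m n} → Graph n → (Fin n → Bool) → Demands m n → Set
Extendable G W D = ∃ λ f → ProperOn G W f × (∀ v → W v ≡ true → Fits D v (f v))

weight : ∀ {m n} → ℕ → Demands m n → Fin n → ℕ
weight k D v = if pre D v then k else ∣ forb D v ∣

record Admissible {m n} (k : ℕ) (G : Graph n) (W : Fin n → Bool) (D : Demands m n) : Set where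
  field
    pre-proper : ∀ u v → W u ≡ true → W v ≡ true → pre D u ≡ true → pre D v ≡ true →
                 Adjacent G u v → col D u ≢ col D v
    forb-small : ∀ v → W v ≡ true → pre D v ≡ false → ∣ forb D v ∣ ≤ k
    cheap      : sumOn W (weight k D) < 2 * (k * k)

Admissible-⊆ : ∀ {k m n} {G : Graph n} {V W : Fin n → Bool} {D : Demands m n} →
               (∀ v → V v ≡ true → W v ≡ true) → Admissible k G W D → Admissible k G V D
Admissible-⊆ {k} {D = D} V⊆W adm = record
  { pre-proper = λ u v u∈ v∈ → pre-proper u v (V⊆W u u∈) (V⊆W v v∈)
  ; forb-small = λ v v∈ → forb-small v (V⊆W v v∈)
  ; cheap      = ≤-<-trans (sumOn-mono-⊆ (weight k D) V⊆W) cheap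
  }
  where open Admissible adm

recolour : ∀ {m n} → Demands m n → (Fin n → Bool) → (Fin n → Fin m) → Demands m n
recolour D Q f = record D { pre = λ v → pre D v ∨ Q v ; col = λ v → if Q v then f v else col D v }

module _ {m n} {G : Graph n} {D : Demands m n} {W₁ : Fin n → Bool} {f : Fin n → Fin m}
         (f-proper : ProperOn G W₁ f) (f-fits : ∀ v → W₁ v ≡ true → Fits D v (f v)) (Q : Fin n → Bool) where

  recolour-col : ∀ v → W₁ v ≡ true → pre (recolour D Q f) v ≡ true → col (recolour D Q f) v ≡ f v
  recolour-col v v∈ pre′ with Q v
  ... | true  = refl
  ... | false = sym (proj₁ (f-fits v v∈) (trans (sym (∨-identityʳ (pre D v))) pre′))

  recolour-pre-proper : ∀ {W₂ : Fin n → Bool} → (∀ v → W₂ v ≡ true → pre (recolour D Q f) v ≡ true → W₁ v ≡ true) →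
    ∀ u v → W₂ u ≡ true → W₂ v ≡ true → pre (recolour D Q f) u ≡ true → pre (recolour D Q f) v ≡ true →
    Adjacent G u v → col (recolour D Q f) u ≢ col (recolour D Q f) v
  recolour-pre-proper W₂⊆W₁ u v u∈ v∈ pre-u pre-v uv eq =
    f-proper u v (W₂⊆W₁ u u∈ pre-u) (W₂⊆W₁ v v∈ pre-v) uv (trans (sym (recolour-col u (W₂⊆W₁ u u∈ pre-u) pre-u))
                                                           (trans eq (recolour-col v (W₂⊆W₁ v v∈ pre-v) pre-v)))

fits-recolour⁻ : ∀ {m n} {D : Demands m n} {Q : Fin n → Bool} {f : Fin n → Fin m} {v x} → Q v ≡ false →
                 Fits (recolour D Q f) v x → Fits D v x
fits-recolour⁻ {D = D} {v = v} Q≡false (agrees , avoids) rewrite Q≡false | ∨-identityʳ (pre D v) = agrees , avoids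

glue : ∀ {m n} {G : Graph n} {D : Demands m n} (L : Fin n → Bool) {Wa Wb : Fin n → Bool} {a b : Fin n → Fin m} →
       ProperOn G Wa a → ProperOn G Wb b →
       (∀ v → L v ≡ true → Wa v ≡ true) → (∀ v → L v ≡ false → Wb v ≡ true) →
       (∀ u v → L u ≡ true → L v ≡ false → Adjacent G u v → a u ≢ b v) →
       (∀ v → L v ≡ true → Fits D v (a v)) → (∀ v → L v ≡ false → Fits D v (b v)) →
       Extendable G (const true) D
glue {m} {n} {G} {D} L {a = a} {b} a-proper b-proper L⊆Wa ∁L⊆Wb cross a-fits b-fits = h , proper , fits
  where
  h : Fin n → Fin m
  h v = if L v then a v else b v
  proper : ProperOn G (const true) h
  proper u v _ _ uv with L u in eu | L v in ev
  ... | true  | true  = a-proper u v (L⊆Wa u eu) (L⊆Wa v ev) uv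
  ... | true  | false = cross u v eu ev uv
  ... | false | true  = cross v u ev eu (trans (adj-sym G v u) uv) ∘ sym
  ... | false | false = b-proper u v (∁L⊆Wb u eu) (∁L⊆Wb v ev) uv
  fits : ∀ v → const true v ≡ true → Fits D v (h v)
  fits v _ with L v in ev
  ... | true  = a-fits v ev
  ... | false = b-fits v ev

demandsOf : ∀ {m n} {G : Graph n} → Template m G → Demands m n
demandsOf T = record { pre = lookup (S T) ; col = c T ; forb = F T }

-- The summand of cost is local to its definition; this names it, so that it unfolds under a with on v ∈? S T.
costSummand : ∀ {n m} {G : Graph n} k (T : Template m G) →
              Σ (Fin n → ℕ) λ t → cost k T ≡ k * ∣ S T ∣ + List.sum (map t (allFin n))
costSummand k T = _ , refl

cost≡sum-weight : ∀ {n m} {G : Graph n} k (T : Template m G) → cost k T ≡ sum (weight k (demandsOf T))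
cost≡sum-weight {n} k T = begin
  cost k T                                                 ≡⟨ proj₂ (costSummand k T) ⟩
  k * ∣ S T ∣ + List.sum (map t (allFin n))                ≡⟨ cong₂ _+_ (cong (k *_) (∣p∣≡count (S T))) (sum-allFin t) ⟩
  k * count (lookup (S T)) + sum t                         ≡⟨ cong (_+ sum t) (*-comm k _) ⟩
  count (lookup (S T)) * k + sum t                         ≡⟨ cong (_+ sum t) (sumOn-const (lookup (S T)) k) ⟨
  sumOn (lookup (S T)) (const k) + sum t                   ≡⟨ ∑-distrib-+ (λ v → if lookup (S T) v then k else 0) t ⟨
  sum (λ v → (if lookup (S T) v then k else 0) + t v)      ≡⟨ sum-cong-≗ summand ⟩
  sum (weight k (demandsOf T))                             ∎
  where
  open ≡-Reasoning
  t = proj₁ (costSummand k T)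
  summand : ∀ v → (if lookup (S T) v then k else 0) + t v ≡ weight k (demandsOf T) v
  summand v with v ∈? S T
  ... | yes v∈S rewrite ∈⇒true v∈S = +-identityʳ k
  ... | no  v∉S rewrite ∉⇒false v∉S = refl

module _ {k m n} {G : Graph n} (W : Fin n → Bool) (D : Demands m n) (adm : Admissible k G W D) where

  open Admissible adm

  private
    preᵢ : Subset (count W)
    preᵢ = Vec.tabulate (pre D ∘ index W)

    lookup-preᵢ : ∀ i → lookup preᵢ i ≡ pre D (index W i)
    lookup-preᵢ = lookup∘tabulate (pre D ∘ index W)

  restrictedTemplate : Template m (induced G (index W))
  restrictedTemplate = record
    { S        = preᵢ
    ; c        = col D ∘ index W
    ; c-proper = λ i j i∈ j∈ → pre-proper (index W i) (index W j) (index-∈ W i) (index-∈ W j)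
                                 (trans (sym (lookup-preᵢ i)) (∈⇒true i∈)) (trans (sym (lookup-preᵢ j)) (∈⇒true j∈))
    ; F        = forb D ∘ index W
    }

  restrictedTemplate-cost : cost k restrictedTemplate ≡ sumOn W (weight k D)
  restrictedTemplate-cost = begin
    cost k restrictedTemplate                       ≡⟨ cost≡sum-weight k restrictedTemplate ⟩
    sum (weight k (demandsOf restrictedTemplate))
      ≡⟨ sum-cong-≗ (λ i → cong (λ b → if b then k else ∣ forb D (index W i) ∣) (lookup-preᵢ i)) ⟩
    sum (weight k D ∘ index W)                      ≡⟨ sum-index W (weight k D) ⟩
    sumOn W (weight k D)                            ∎
    where open ≡-Reasoning

  restrictedTemplate-forb-small : ∀ i → i ∉ preᵢ → ∣ forb D (index W i) ∣ ≤ k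
  restrictedTemplate-forb-small i i∉ = forb-small (index W i) (index-∈ W i) (trans (sym (lookup-preᵢ i)) (∉⇒false i∉))

  extend-restricted : (Σ (Fin (count W) → Fin m) λ f → Proper m (induced G (index W)) f × Respects restrictedTemplate f) →
                      Extendable G W D
  extend-restricted (f , proper , agrees , avoids) = pullback W f (col D) , properOn , fits
    where
    f-index : ∀ i → pullback W f (col D) (index W i) ≡ f i
    f-index = pullback-index W f (col D)
    properOn : ProperOn G W (pullback W f (col D))
    properOn u v u∈ v∈ uv with index-preimage W u u∈ | index-preimage W v v∈
    ... | i , refl | j , refl = λ eq → proper i j uv (trans (sym (f-index i)) (trans eq (f-index j)))
    fits : ∀ v → W v ≡ true → Fits D v (pullback W f (col D) v)
    fits v v∈ with index-preimage W v v∈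
    ... | i , refl = (λ pre≡true → trans (f-index i) (agrees i (true⇒∈ (trans (lookup-preᵢ i) pre≡true))))
                   , (λ pre≡false → subst (_∉ forb D (index W i)) (sym (f-index i))
                                      (avoids i (false⇒∉ (trans (lookup-preᵢ i) pre≡false))))

demandsOf-admissible : ∀ {k m n} {G : Graph n} (T : Template m G) → cost k T < 2 * (k * k) →
                       (∀ v → v ∉ S T → ∣ F T v ∣ ≤ k) → Admissible k G (const true) (demandsOf T)
demandsOf-admissible {k} T cost< forb≤k = record
  { pre-proper = λ u v _ _ u∈S v∈S → c-proper T u v (true⇒∈ u∈S) (true⇒∈ v∈S)
  ; forb-small = λ v _ v∉S → forb≤k v (false⇒∉ v∉S)
  ; cheap      = subst (_< 2 * (k * k)) (cost≡sum-weight k T) cost<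
  }

¬respects⇒¬extendable : ∀ {m n} {G : Graph n} (T : Template m G) →
                        ¬ (Σ (Fin n → Fin m) λ f → Proper m G f × Respects T f) → ¬ Extendable G (const true) (demandsOf T)
¬respects⇒¬extendable T uncolourable (f , proper , fits) = uncolourable
  ( f , (λ u v → proper u v refl refl)
  , (λ v v∈S → proj₁ (fits v refl) (∈⇒true v∈S)) , λ v v∉S → proj₂ (fits v refl) (∉⇒false v∉S))

-- Only a doubly negated colouring is available, since Extensible is defined as ¬ Inextensible.
ExtensibleOnProperSubsets : ∀ {n} (k m : ℕ) → Graph n → Set
ExtensibleOnProperSubsets {n} k m G = ∀ (W : Fin n → Bool) v₀ → W v₀ ≡ false →
  (D : Demands m n) → Admissible k G W D → ¬ ¬ Extendable G W D

minimal⇒extensibleOnProperSubsets : ∀ {k m n} {G : Graph n} →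
  (∀ n′ (ι : Fin n′ → Fin n) → Injective _≡_ _≡_ ι → n′ < n → Extensible k m (induced G ι)) →
  ExtensibleOnProperSubsets k m G
minimal⇒extensibleOnProperSubsets {k} minimal W v₀ v₀∉W D adm ¬ext =
  minimal (count W) (index W) (index-injective W) (count<n W v₀ v₀∉W)
    ( restrictedTemplate W D adm
    , subst (_< 2 * (k * k)) (sym (restrictedTemplate-cost W D adm)) (Admissible.cheap adm)
    , restrictedTemplate-forb-small W D adm
    , ¬ext ∘ extend-restricted W D adm )

-- Graphs and separations

only : ∀ {n} → Fin n → Fin n → Bool
only y v = does (v ≟ y)

only-≡ : ∀ {n} (y v : Fin n) → only y v ≡ true → v ≡ y
only-≡ y v eq with v ≟ y
... | yes v≡y = v≡y

only-self : ∀ {n} (y : Fin n) → only y y ≡ true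
only-self y with y ≟ y
... | yes _   = refl
... | no  y≢y = contradiction refl y≢y

only-proper : ∀ {m n} (G : Graph n) y (x : Fin m) → ProperOn G (only y) (const x)
only-proper G y x u v u≡y v≡y uv with refl ← only-≡ y u u≡y | refl ← only-≡ y v v≡y with () ← trans (sym uv) (irrefl G y)

degree : ∀ {n} → Graph n → Fin n → ℕ
degree G y = count (adj G y)

degree<n : ∀ {n} (G : Graph n) y → degree G y < n
degree<n G y = count<n (adj G y) y (irrefl G y)

record Separation {n} (G : Graph n) (X : Fin n → Bool) : Set where
  field
    left right : Fin n → Bool
    covers     : ∀ v → left v ≡ false → right v ≡ false → X v ≡ true
    disjoint   : ∀ v → left v ≡ true → right v ≡ false
    left-∉X    : ∀ v → left v ≡ true → X v ≡ false
    right-∉X   : ∀ v → right v ≡ true → X v ≡ false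
    no-edge    : ∀ u v → left u ≡ true → right v ≡ true → ¬ Adjacent G u v
    left-root  : Fin n
    left-root-∈  : left left-root ≡ true
    right-root : Fin n
    right-root-∈ : right right-root ≡ true

  boundary : ∀ u v → left u ≡ true → left v ≡ false → Adjacent G u v → X v ≡ true
  boundary u v u∈ v∉ uv with right v in eq
  ... | true  = contradiction uv (no-edge u v u∈ eq)
  ... | false = covers v v∉ eq

  right⇒¬left : ∀ v → right v ≡ true → left v ≡ false
  right⇒¬left v = exclusive-sym (disjoint v)

  X⇒¬left : ∀ v → X v ≡ true → left v ≡ false
  X⇒¬left v = exclusive-sym (left-∉X v)

  swap : Separation G X
  swap = record
    { left = right ; right = left
    ; covers = λ v r l → covers v l r
    ; disjoint = right⇒¬left
    ; left-∉X = right-∉X ; right-∉X = left-∉X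
    ; no-edge = λ u v u∈ v∈ uv → no-edge v u v∈ u∈ (trans (adj-sym G v u) uv)
    ; left-root = right-root ; left-root-∈ = right-root-∈
    ; right-root = left-root ; right-root-∈ = left-root-∈
    }

reach-∉ : ∀ {n} {G : Graph n} {X : Subset n} {u v} → u ∉ X → Reach G X u v → v ∉ X
reach-∉ u∉X here             = u∉X
reach-∉ u∉X (step _ _ v∉X) = v∉X

module _ {n} {G : Graph n} {X : Subset n} {u v : Fin n} (u∉X : u ∉ X) (v∉X : v ∉ X)
         (unreachable : ¬ Reach G X u v) (reach? : ∀ w → Dec (Reach G X u w)) where

  private
    reached : Fin n → Bool
    reached w = does (reach? w)

    reached⇒reach : ∀ w → reached w ≡ true → Reach G X u w
    reached⇒reach w eq with reach? w
    ... | yes r = r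

    reach⇒reached : ∀ w → Reach G X u w → reached w ≡ true
    reach⇒reached w r with reach? w
    ... | yes _ = refl
    ... | no ¬r = contradiction r ¬r

    rest : Fin n → Bool
    rest w = not (reached w) ∧ not (lookup X w)

    rest⇒∉X : ∀ w → rest w ≡ true → lookup X w ≡ false
    rest⇒∉X w eq with lookup X w
    ... | false = refl
    ... | true with () ← trans (sym eq) (∧-zeroʳ (not (reached w)))

    rest⇒¬reached : ∀ w → rest w ≡ true → reached w ≡ false
    rest⇒¬reached w eq with reached w
    ... | false = refl

  unreachable-separation : Separation G (lookup X)
  unreachable-separation = record
    { left = reached ; right = rest
    ; covers = covers
    ; disjoint = λ w r → cong (λ b → not b ∧ not (lookup X w)) r
    ; left-∉X = λ w r → ∉⇒false (reach-∉ u∉X (reached⇒reach w r))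
    ; right-∉X = rest⇒∉X
    ; no-edge = no-edge
    ; left-root = u ; left-root-∈ = reach⇒reached u here
    ; right-root = v ; right-root-∈ = v-rest
    }
    where
    covers : ∀ w → reached w ≡ false → rest w ≡ false → lookup X w ≡ true
    covers w r eq with reached w | lookup X w
    ... | false | true  = refl
    ... | false | false with () ← eq
    no-edge : ∀ a b → reached a ≡ true → rest b ≡ true → ¬ Adjacent G a b
    no-edge a b a∈ b∈ ab with () ← trans (sym (reach⇒reached b (step (reached⇒reach a a∈) ab (false⇒∉ (rest⇒∉X b b∈)))))
                                        (rest⇒¬reached b b∈)
    v-rest : rest v ≡ true
    v-rest with reach? v
    ... | yes r = contradiction r unreachable
    ... | no _ rewrite ∉⇒false v∉X = refl

¬¬-sequence : ∀ {n} {P : Fin n → Set} → (∀ i → ¬ ¬ P i) → ¬ ¬ (∀ i → P i)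
¬¬-sequence = sequence (RawMonad.rawApplicative ¬¬-Monad)

¬¬-Π : ∀ {A B : Set} → (A → ¬ ¬ B) → ¬ ¬ (A → B)
¬¬-Π f ¬[a→b] = ¬[a→b] λ a → ⊥-elim (f a (¬[a→b] ∘ const))

cutset⇒¬¬separation : ∀ {n} {G : Graph n} {X : Subset n} → IsCutset G X → ¬ ¬ Separation G (lookup X)
cutset⇒¬¬separation {G = G} {X} cut ¬separation = connected cut
  where
  connected : ¬ ¬ ConnectedWithout G X
  connected = ¬¬-sequence λ u → ¬¬-sequence λ v → ¬¬-Π λ u∉X → ¬¬-Π λ v∉X unreachable →
    ¬¬-sequence (λ w → ¬¬-excluded-middle) (¬separation ∘ unreachable-separation u∉X v∉X unreachable)

m+2≤k+n⇒m∸k+1<n : ∀ {k m n} → k ≤ m → m + 2 ≤ k + n → m ∸ k + 1 < n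
m+2≤k+n⇒m∸k+1<n {k} {m} {n} k≤m m+2≤k+n = begin
  suc (m ∸ k + 1) ≡⟨ +-suc (m ∸ k) 1 ⟨
  m ∸ k + 2    ≡⟨ +-∸-comm 2 k≤m ⟨
  m + 2 ∸ k    ≤⟨ ∸-monoˡ-≤ k m+2≤k+n ⟩
  k + n ∸ k    ≡⟨ m+n∸m≡n k n ⟩
  n            ∎
  where open ≤-Reasoning

m∸1≤n⇒m≤n+1 : ∀ {m n} → m ∸ 1 ≤ n → m ≤ n + 1
m∸1≤n⇒m≤n+1 {m} {n} m∸1≤n = ≤-trans (m≤n+m∸n m 1) (≤-trans (+-monoʳ-≤ 1 m∸1≤n) (≤-reflexive (+-comm 1 n)))

1≤k⇒3k≤m+1⇒2k≤m : ∀ {k m} → 1 ≤ k → 3 * k ≤ m + 1 → k + k ≤ m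
1≤k⇒3k≤m+1⇒2k≤m {k} {m} 1≤k 3k≤m+1 = +-cancelʳ-≤ 1 (k + k) m (begin
  k + k + 1   ≤⟨ +-monoʳ-≤ (k + k) 1≤k ⟩
  k + k + k   ≡⟨ solve 1 (λ k → k :+ k :+ k := con 3 :* k) refl k ⟩
  3 * k       ≤⟨ 3k≤m+1 ⟩
  m + 1       ∎)
  where
  open ≤-Reasoning
  open +-*-Solver

-- With k = t + b, the hypotheses (scaled by k and by b) add up to t · 2k² ≤ t · (ks + σ).
cut-arithmetic : ∀ {k t s σ} → 0 < t → t ≤ k → σ ≤ k * t → 3 * k * t ≤ σ + (s + t) * t → 2 * (k * k) ≤ k * s + σ
cut-arithmetic {k} {t} {s} {σ} 0<t t≤k σ≤kt 3kt≤ with b , refl ← m≤n⇒∃[o]m+o≡n t≤k =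
  *-cancelˡ-≤ t {{>-nonZero 0<t}} (+-cancelʳ-≤ ((t + b) * (t + b) * t + b * σ) _ _ (begin
    t * (2 * ((t + b) * (t + b))) + ((t + b) * (t + b) * t + b * σ) ≡⟨ lhs t b σ ⟩
    (t + b) * (3 * (t + b) * t) + b * σ                           ≤⟨ +-mono-≤ (*-monoʳ-≤ (t + b) 3kt≤) (*-monoʳ-≤ b σ≤kt) ⟩
    (t + b) * (σ + (s + t) * t) + b * ((t + b) * t)               ≡⟨ rhs t b s σ ⟩
    t * ((t + b) * s + σ) + ((t + b) * (t + b) * t + b * σ)       ∎))
  where
  open ≤-Reasoning
  open +-*-Solver
  lhs : ∀ t b σ → t * (2 * ((t + b) * (t + b))) + ((t + b) * (t + b) * t + b * σ) ≡ (t + b) * (3 * (t + b) * t) + b * σ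
  lhs = solve 3 (λ t b σ → t :* (con 2 :* ((t :+ b) :* (t :+ b))) :+ ((t :+ b) :* (t :+ b) :* t :+ b :* σ)
                         := (t :+ b) :* (con 3 :* (t :+ b) :* t) :+ b :* σ) refl
  rhs : ∀ t b s σ → (t + b) * (σ + (s + t) * t) + b * ((t + b) * t) ≡ t * ((t + b) * s + σ) + ((t + b) * (t + b) * t + b * σ)
  rhs = solve 4 (λ t b s σ → (t :+ b) :* (σ :+ (s :+ t) :* t) :+ b :* ((t :+ b) :* t)
                           := t :* ((t :+ b) :* s :+ σ) :+ ((t :+ b) :* (t :+ b) :* t :+ b :* σ)) refl

-- Minimally inextensible graphs

module Critical {k m n} {G : Graph n} (extensible : ExtensibleOnProperSubsets k m G) (D : Demands m n)
             (admissible : Admissible k G (const true) D) (stuck : ¬ Extendable G (const true) D) where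

  open Admissible admissible

  w : Fin n → ℕ
  w = weight k D

  sumOn-precoloured : ∀ V → (∀ v → V v ≡ true → pre D v ≡ true) → sumOn V w ≡ count V * k
  sumOn-precoloured V V⊆pre =
    trans (sumOn-cong V λ v v∈ → cong (λ b → if b then k else ∣ forb D v ∣) (V⊆pre v v∈)) (sumOn-const V k)

  sumOn-unprecoloured : ∀ V → (∀ v → V v ≡ true → pre D v ≡ false) → sumOn V w ≡ sumOn V (λ v → ∣ forb D v ∣)
  sumOn-unprecoloured V V∩pre≡∅ = sumOn-cong V λ v v∈ → cong (λ b → if b then k else ∣ forb D v ∣) (V∩pre≡∅ v v∈)

  colours≤forb+degree : ∀ y → pre D y ≡ false → m ≤ ∣ forb D y ∣ + degree G y
  colours≤forb+degree y y∉pre = ≮⇒≥ λ few-colours →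
    extensible others y (cong not (only-self y)) D (Admissible-⊆ (λ _ _ → refl) admissible) λ (f , f-proper , f-fits) →
    stuck (colour-y f-proper f-fits (colour-avoiding (forb D y) (adj G y) f few-colours))
    where
    others : Fin n → Bool
    others v = not (only y v)
    colour-y : ∀ {f} → ProperOn G others f → (∀ v → others v ≡ true → Fits D v (f v)) →
               (∃ λ x → x ∉ forb D y × ∀ u → Adjacent G y u → f u ≢ x) → Extendable G (const true) D
    colour-y {f} f-proper f-fits (x , x∉forb , x-new) =
      glue {G = G} {D = D} (only y) (only-proper G y x) f-proper (λ _ → id) (λ v → cong not)
           cross fits-y (λ v → f-fits v ∘ cong not)
      where
      cross : ∀ u v → only y u ≡ true → only y v ≡ false → Adjacent G u v → x ≢ f v
      cross u v u≡y _ uv with refl ← only-≡ y u u≡y = x-new v uv ∘ sym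
      fits-y : ∀ v → only y v ≡ true → Fits D v x
      fits-y v v≡y with refl ← only-≡ y v v≡y = (λ y∈pre → contradiction (trans (sym y∈pre) y∉pre) λ ()) , λ _ → x∉forb

  colours<forb+order : ∀ y → pre D y ≡ false → m < ∣ forb D y ∣ + n
  colours<forb+order y y∉pre = ≤-<-trans (colours≤forb+degree y y∉pre) (+-monoʳ-< ∣ forb D y ∣ (degree<n G y))

  unprecoloured : ∃ λ y → pre D y ≡ false
  unprecoloured with any? (λ v → pre D v Bool.≟ false)
  ... | yes found = found
  ... | no none = contradiction (col D , proper , λ v _ → (λ _ → refl) , λ eq → contradiction (_ , eq) none) stuck
    where
    all-pre : ∀ v → pre D v ≡ true
    all-pre v = ¬-not (λ eq → none (v , eq))
    proper : ProperOn G (const true) (col D)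
    proper u v _ _ = pre-proper u v refl refl (all-pre u) (all-pre v)

  order-bound : k ≤ m → 3 * k ≤ m + 1 → m ∸ k + 1 < n
  order-bound k≤m 3k≤m+1 with any? (λ v → (pre D v Bool.≟ false) ×-dec (∣ forb D v ∣ <? k))
  ... | yes (y , y∉pre , light) = m+2≤k+n⇒m∸k+1<n k≤m (begin
    m + 2                   ≡⟨ +-comm m 2 ⟩
    suc (suc m)             ≤⟨ s≤s (colours<forb+order y y∉pre) ⟩
    suc ∣ forb D y ∣ + n    ≤⟨ +-monoˡ-≤ n light ⟩
    k + n                   ∎)
    where open ≤-Reasoning
  ... | no ¬light = contradiction cheap (≤⇒≯ (begin
    2 * (k * k)   ≡⟨ *-assoc 2 k k ⟨
    2 * k * k     ≤⟨ *-monoˡ-≤ k 2k≤n ⟩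
    n * k         ≡⟨ sum-const n k ⟨
    sum {n} (const k) ≤⟨ sum-mono-≤ heavy ⟩
    sum w         ∎))
    where
    open ≤-Reasoning
    heavy : ∀ v → k ≤ w v
    heavy v with pre D v in eq
    ... | true  = ≤-refl
    ... | false = ≮⇒≥ λ light → ¬light (v , eq , light)
    2k≤n : 2 * k ≤ n
    2k≤n with y , y∉pre ← unprecoloured = +-cancelˡ-≤ k (2 * k) n (≤-trans 3k≤m+1 (begin
      m + 1              ≡⟨ +-comm m 1 ⟩
      suc m              ≤⟨ colours<forb+order y y∉pre ⟩
      ∣ forb D y ∣ + n   ≤⟨ +-monoˡ-≤ n (forb-small y refl y∉pre) ⟩
      k + n              ∎))

  module CheapSide {X : Fin n → Bool} (sep : Separation G X)
                   (p : Fin n) (p∈left : Separation.left sep p ≡ true) (p∉pre : pre D p ≡ false)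
                   (light : sumOn (Separation.left sep) w + count X * k < 2 * (k * k)) where

    open Separation sep

    W₁ W₂ : Fin n → Bool
    W₁ v = not (left v) ∨ pre D v
    W₂ v = left v ∨ X v

    ¬left⇒W₁ : ∀ v → left v ≡ false → W₁ v ≡ true
    ¬left⇒W₁ v eq = cong (λ b → not b ∨ pre D v) eq

    W₁-p : W₁ p ≡ false
    W₁-p rewrite p∈left | p∉pre = refl

    W₂-right-root : W₂ right-root ≡ false
    W₂-right-root rewrite right⇒¬left right-root right-root-∈ = right-∉X right-root right-root-∈

    W₂-precoloured⊆W₁ : ∀ v → W₂ v ≡ true → (pre D v ∨ X v) ≡ true → W₁ v ≡ true
    W₂-precoloured⊆W₁ v _ pre′ with X v in eq
    ... | true  = ¬left⇒W₁ v (X⇒¬left v eq)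
    ... | false = trans (cong (not (left v) ∨_) (trans (sym (∨-identityʳ (pre D v))) pre′)) (∨-zeroʳ (not (left v)))

    weight₂≤ : ∀ (f : Fin n → Fin m) v →
               (if W₂ v then weight k (recolour D X f) v else 0) ≤ (if left v then w v else 0) + (if X v then k else 0)
    weight₂≤ f v with left v in el | X v in ex
    ... | true  | true  with () ← trans (sym ex) (left-∉X v el)
    ... | true  | false rewrite ∨-identityʳ (pre D v) = m≤m+n (w v) 0
    ... | false | true  rewrite ∨-zeroʳ (pre D v) = ≤-refl
    ... | false | false = z≤n

    admissible₂ : ∀ {f} → ProperOn G W₁ f → (∀ v → W₁ v ≡ true → Fits D v (f v)) → Admissible k G W₂ (recolour D X f)
    admissible₂ {f} f-proper f-fits = record
      { pre-proper = recolour-pre-proper {G = G} {D = D} f-proper f-fits X W₂-precoloured⊆W₁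
      ; forb-small = λ v _ pre′ → forb-small v refl (∨-conicalˡ (pre D v) (X v) pre′)
      ; cheap      = ≤-<-trans (sum-mono-≤ (weight₂≤ f)) (subst (_< 2 * (k * k)) cost-split light)
      }
      where
      cost-split : sumOn left w + count X * k ≡ sum (λ v → (if left v then w v else 0) + (if X v then k else 0))
      cost-split = trans (cong (sumOn left w +_) (sym (sumOn-const X k)))
                         (sym (∑-distrib-+ (λ v → if left v then w v else 0) (λ v → if X v then k else 0)))

    glued : ∀ {f₁ f₂} → ProperOn G W₁ f₁ → (∀ v → W₁ v ≡ true → Fits D v (f₁ v)) →
            ProperOn G W₂ f₂ → (∀ v → W₂ v ≡ true → Fits (recolour D X f₁) v (f₂ v)) → Extendable G (const true) D
    glued {f₁} {f₂} f₁-proper f₁-fits f₂-proper f₂-fits =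
      glue {G = G} {D = D} left f₂-proper f₁-proper (λ v → cong (_∨ X v)) ¬left⇒W₁ cross
        (λ v v∈ → fits-recolour⁻ {D = D} {Q = X} {f = f₁} (left-∉X v v∈) (f₂-fits v (cong (_∨ X v) v∈)))
        (λ v v∉ → f₁-fits v (¬left⇒W₁ v v∉))
      where
      X⇒W₂ : ∀ v → X v ≡ true → W₂ v ≡ true
      X⇒W₂ v x = trans (cong (left v ∨_) x) (∨-zeroʳ (left v))
      f₂≡f₁-on-X : ∀ v → X v ≡ true → f₂ v ≡ f₁ v
      f₂≡f₁-on-X v x = trans (proj₁ (f₂-fits v (X⇒W₂ v x)) pre′)
                             (recolour-col {G = G} f₁-proper f₁-fits X v (¬left⇒W₁ v (X⇒¬left v x)) pre′)
        where pre′ = trans (cong (pre D v ∨_) x) (∨-zeroʳ (pre D v))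
      cross : ∀ u v → left u ≡ true → left v ≡ false → Adjacent G u v → f₂ u ≢ f₁ v
      cross u v u∈ v∉ uv eq = f₂-proper u v (cong (_∨ X u) u∈) (X⇒W₂ v x) uv (trans eq (sym (f₂≡f₁-on-X v x)))
        where x = boundary u v u∈ v∉ uv

  cheap-side : ∀ {X} (sep : Separation G X) p → Separation.left sep p ≡ true → pre D p ≡ false →
               sumOn (Separation.left sep) w + count X * k < 2 * (k * k) → ⊥
  cheap-side {X} sep p p∈left p∉pre light =
    extensible W₁ p W₁-p D (Admissible-⊆ (λ _ _ → refl) admissible) λ (f₁ , f₁-proper , f₁-fits) →
    extensible W₂ right-root W₂-right-root (recolour D X f₁) (admissible₂ f₁-proper f₁-fits) λ (_ , f₂-proper , f₂-fits) →
    stuck (glued f₁-proper f₁-fits f₂-proper f₂-fits)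
    where
    open Separation sep
    open CheapSide sep p p∈left p∉pre light

  module PrecolouredSide {X : Fin n → Bool} (X≤k : count X ≤ k) (sep : Separation G X)
                         (left⊆pre : ∀ v → Separation.left sep v ≡ true → pre D v ≡ true)
                         (q : Fin n) (q∈right : Separation.right sep q ≡ true) (q∉pre : pre D q ≡ false) where

    open Separation sep

    W₁ W₂ : Fin n → Bool
    W₁ v = not (right v ∧ not (pre D v))
    W₂ v = not (left v)

    W₁-q : W₁ q ≡ false
    W₁-q rewrite q∈right | q∉pre = refl

    W₂-left-root : W₂ left-root ≡ false
    W₂-left-root = cong not left-root-∈

    X⇒W₁ : ∀ v → X v ≡ true → W₁ v ≡ true
    X⇒W₁ v x = cong (λ b → not (b ∧ not (pre D v))) (Separation.X⇒¬left swap v x)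

    pre⇒W₁ : ∀ v → pre D v ≡ true → W₁ v ≡ true
    pre⇒W₁ v p = trans (cong (λ b → not (right v ∧ not b)) p) (cong not (∧-zeroʳ (right v)))

    left-proper : ProperOn G left (col D)
    left-proper u v u∈ v∈ = pre-proper u v refl refl (left⊆pre u u∈) (left⊆pre v v∈)

    left-fits : ∀ v → left v ≡ true → Fits D v (col D v)
    left-fits v v∈ = (λ _ → refl) , λ v∉pre → contradiction (trans (sym (left⊆pre v v∈)) v∉pre) λ ()

    forb∪leftColours : Fin n → Subset m
    forb∪leftColours v = forb D v ∪ imageOn (λ u → left u ∧ adj G v u) (col D)

    ∣forb∪leftColours∣≤ : ∀ v → ∣ forb∪leftColours v ∣ ≤ ∣ forb D v ∣ + count left
    ∣forb∪leftColours∣≤ v = ≤-trans (∣p∪q∣≤∣p∣+∣q∣ (forb D v) _) (+-monoʳ-≤ ∣ forb D v ∣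
      (≤-trans (∣imageOn∣≤count _ (col D)) (sumOn-mono-⊆ (const 1) λ u eq → ∧-conicalˡ (left u) (adj G v u) eq)))

    overloaded : Fin n → Bool
    overloaded v = X v ∧ (k <ᵇ ∣ forb∪leftColours v ∣)

    demands₂ : (Fin n → Fin m) → Demands m n
    demands₂ g = record (recolour D overloaded g) { forb = λ v → if X v then forb∪leftColours v else forb D v }

    pre₂⇒W₁ : ∀ g v → W₂ v ≡ true → pre (demands₂ g) v ≡ true → W₁ v ≡ true
    pre₂⇒W₁ g v _ pre′ = [ pre⇒W₁ v , X⇒W₁ v ∘ ∧-conicalˡ (X v) _ ]′ (∨-true (pre D v) pre′)

    ¬overloaded⇒forb₂-small : ∀ g v → pre D v ≡ false → overloaded v ≡ false → ∣ forb (demands₂ g) v ∣ ≤ k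
    ¬overloaded⇒forb₂-small g v v∉pre ¬o with X v
    ... | false = forb-small v refl v∉pre
    ... | true = ≮⇒≥ λ k< → subst T ¬o (<⇒<ᵇ k<)

    weight₂≤ : ∀ g v → weight k (demands₂ g) v ≤ w v + (if X v then count left else 0)
    weight₂≤ g v with pre D v
    ... | true = m≤m+n k _
    ... | false with X v
    ...   | false = ≤-reflexive (sym (+-identityʳ _))
    ...   | true with k <ᵇ ∣ forb∪leftColours v ∣ in eq
    ...     | true  = ≤-trans (<⇒≤ (<ᵇ⇒< k _ (subst T (sym eq) _))) (∣forb∪leftColours∣≤ v)
    ...     | false = ∣forb∪leftColours∣≤ v

    cost₂≤ : ∀ g → sumOn W₂ (weight k (demands₂ g)) ≤ sum w
    cost₂≤ g = begin
      sumOn W₂ (weight k (demands₂ g))                              ≤⟨ sumOn-mono-≤ W₂ (λ v _ → weight₂≤ g v) ⟩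
      sumOn W₂ (λ v → w v + (if X v then count left else 0))       ≡⟨ sumOn-+ W₂ w _ ⟩
      sumOn W₂ w + sumOn W₂ (λ v → if X v then count left else 0)  ≤⟨ +-monoʳ-≤ (sumOn W₂ w) (sumOn-≤-sum W₂ _) ⟩
      sumOn W₂ w + sumOn X (const (count left))                     ≡⟨ cong (sumOn W₂ w +_) (sumOn-const X (count left)) ⟩
      sumOn W₂ w + count X * count left                             ≤⟨ +-monoʳ-≤ (sumOn W₂ w) (*-monoˡ-≤ (count left) X≤k) ⟩
      sumOn W₂ w + k * count left                                   ≡⟨ cong (sumOn W₂ w +_) (trans (*-comm k _) (sym (sumOn-precoloured left left⊆pre))) ⟩
      sumOn W₂ w + sumOn left w                                     ≡⟨ +-comm (sumOn W₂ w) _ ⟩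
      sumOn left w + sumOn W₂ w                                     ≡⟨ sum-split left w ⟨
      sum w                                                         ∎
      where open ≤-Reasoning

    admissible₂ : ∀ {g} → ProperOn G W₁ g → (∀ v → W₁ v ≡ true → Fits D v (g v)) → Admissible k G W₂ (demands₂ g)
    admissible₂ {g} g-proper g-fits = record
      { pre-proper = recolour-pre-proper {G = G} {D = D} g-proper g-fits overloaded (pre₂⇒W₁ g)
      ; forb-small = λ v _ pre′ → ¬overloaded⇒forb₂-small g v (∨-conicalˡ (pre D v) _ pre′) (∨-conicalʳ (pre D v) _ pre′)
      ; cheap      = ≤-<-trans (cost₂≤ g) cheap
      }

    module _ {g h : Fin n → Fin m} (g-proper : ProperOn G W₁ g) (g-fits : ∀ v → W₁ v ≡ true → Fits D v (g v))
             (h-fits : ∀ v → W₂ v ≡ true → Fits (demands₂ g) v (h v)) where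

      h≡g-on-precoloured₂ : ∀ v → W₂ v ≡ true → pre (demands₂ g) v ≡ true → h v ≡ g v
      h≡g-on-precoloured₂ v v∈ pre′ =
        trans (proj₁ (h-fits v v∈) pre′) (recolour-col {G = G} g-proper g-fits overloaded v (pre₂⇒W₁ g v v∈ pre′) pre′)

      h-pre : ∀ v → W₂ v ≡ true → pre D v ≡ true → h v ≡ col D v
      h-pre v v∈ v∈pre = trans (h≡g-on-precoloured₂ v v∈ pre′) (proj₁ (g-fits v (pre⇒W₁ v v∈pre)) v∈pre)
        where pre′ = cong (_∨ overloaded v) v∈pre

      h-avoids-forb₂ : ∀ v → W₂ v ≡ true → pre D v ≡ false → overloaded v ≡ false → h v ∉ forb (demands₂ g) v
      h-avoids-forb₂ v v∈ v∉pre ¬o = proj₂ (h-fits v v∈) (trans (cong (_∨ overloaded v) v∉pre) ¬o)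

      forb⊆forb₂ : ∀ v {x} → x ∈ forb D v → x ∈ forb (demands₂ g) v
      forb⊆forb₂ v with X v
      ... | true  = x∈p∪q⁺ ∘ inj₁
      ... | false = id

      h-fits-D : ∀ v → left v ≡ false → Fits D v (h v)
      h-fits-D v v∉ = h-pre v (cong not v∉) , avoid
        where
        avoid : pre D v ≡ false → h v ∉ forb D v
        avoid v∉pre with overloaded v in eo
        ... | true  = subst (_∉ forb D v) (sym (h≡g-on-precoloured₂ v (cong not v∉) (trans (cong (_∨ overloaded v) v∉pre) eo)))
                        (proj₂ (g-fits v (X⇒W₁ v (∧-conicalˡ (X v) _ eo))) v∉pre)
        ... | false = h-avoids-forb₂ v (cong not v∉) v∉pre eo ∘ forb⊆forb₂ v

      cross : ∀ u v → left u ≡ true → left v ≡ false → Adjacent G u v → col D u ≢ h v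
      cross u v u∈ v∉ uv with boundary u v u∈ v∉ uv | pre D v in ep | overloaded v in eo
      ... | x | true | _ = λ eq → pre-proper u v refl refl (left⊆pre u u∈) ep uv (trans eq (h-pre v (cong not v∉) ep))
      ... | x | false | true = λ eq → g-proper u v (pre⇒W₁ u (left⊆pre u u∈)) (X⇒W₁ v x) uv
            (trans (proj₁ (g-fits u (pre⇒W₁ u (left⊆pre u u∈))) (left⊆pre u u∈))
              (trans eq (h≡g-on-precoloured₂ v (cong not v∉) (trans (cong (_∨ overloaded v) ep) eo))))
      ... | x | false | false = λ eq →
            h-avoids-forb₂ v (cong not v∉) ep eo (subst (_∈ forb (demands₂ g) v) eq in-forb∪leftColours)
        where
        in-forb∪leftColours : col D u ∈ forb (demands₂ g) v
        in-forb∪leftColours rewrite x =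
          x∈p∪q⁺ (inj₂ (imageOn-∈ _ (col D) u (trans (cong (_∧ adj G v u) u∈) (trans (adj-sym G v u) uv))))

  precoloured-side : ∀ {X} → count X ≤ k → (sep : Separation G X) →
                     (∀ v → Separation.left sep v ≡ true → pre D v ≡ true) →
                     ∀ q → Separation.right sep q ≡ true → pre D q ≡ false → ⊥
  precoloured-side X≤k sep left⊆pre q q∈right q∉pre =
    extensible W₁ q W₁-q D (Admissible-⊆ (λ _ _ → refl) admissible) λ (g , g-proper , g-fits) →
    extensible W₂ left-root W₂-left-root (demands₂ g) (admissible₂ g-proper g-fits) λ (h , h-proper , h-fits) →
    stuck (glue {G = G} {D = D} left left-proper h-proper (λ _ → id) (λ v → cong not)
                (cross g-proper g-fits h-fits) left-fits (h-fits-D g-proper g-fits h-fits))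
    where
    open Separation sep
    open PrecolouredSide X≤k sep left⊆pre q q∈right q∉pre

  colours-on-unprecoloured : ∀ V → (∀ v → V v ≡ true → pre D v ≡ false) →
                             (m + 1) * count V ≤ sumOn V (λ v → ∣ forb D v ∣) + n * count V
  colours-on-unprecoloured V V∩pre≡∅ = begin
    (m + 1) * count V                                ≡⟨ *-comm (m + 1) (count V) ⟩
    count V * (m + 1)                                ≡⟨ sumOn-const V (m + 1) ⟨
    sumOn V (const (m + 1))                          ≤⟨ sumOn-mono-≤ V many-forbidden ⟩
    sumOn V (λ v → ∣ forb D v ∣ + n)                 ≡⟨ sumOn-+ V (λ v → ∣ forb D v ∣) (const n) ⟩
    sumOn V (λ v → ∣ forb D v ∣) + sumOn V (const n)
      ≡⟨ cong (sumOn V (λ v → ∣ forb D v ∣) +_) (trans (sumOn-const V n) (*-comm (count V) n)) ⟩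
    sumOn V (λ v → ∣ forb D v ∣) + n * count V       ∎
    where
    open ≤-Reasoning
    many-forbidden : ∀ v → V v ≡ true → m + 1 ≤ ∣ forb D v ∣ + n
    many-forbidden v v∈ = subst (_≤ ∣ forb D v ∣ + n) (+-comm 1 m) (colours<forb+order v (V∩pre≡∅ v v∈))

  cut-covers-unprecoloured : 3 * k ≤ m + 1 → ∀ {X} → count X ≤ k → (∀ v → pre D v ≡ false → X v ≡ true) → ⊥
  cut-covers-unprecoloured 3k≤m+1 {X} X≤k free⊆X = contradiction cheap (≤⇒≯ (begin
    2 * (k * k)                   ≤⟨ cut-arithmetic 0<t t≤k σ≤kt 3kt≤ ⟩
    k * count (pre D) + σ         ≡⟨ cong (_+ σ) (*-comm k _) ⟩
    count (pre D) * k + σ         ≡⟨ cong₂ _+_ (sumOn-precoloured (pre D) λ _ → id) (sumOn-unprecoloured free free⇒¬pre) ⟨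
    sumOn (pre D) w + sumOn free w ≡⟨ sum-split (pre D) w ⟨
    sum w                         ∎))
    where
    open ≤-Reasoning
    free : Fin n → Bool
    free = not ∘ pre D
    t σ : ℕ
    t = count free
    σ = sumOn free (λ v → ∣ forb D v ∣)
    free⇒¬pre : ∀ v → free v ≡ true → pre D v ≡ false
    free⇒¬pre v eq = trans (sym (Bool.not-involutive (pre D v))) (cong not eq)
    0<t : 0 < t
    0<t with y , y∉pre ← unprecoloured = 0<count free y (cong not y∉pre)
    t≤k : t ≤ k
    t≤k = ≤-trans (sumOn-mono-⊆ (const 1) λ v eq → free⊆X v (free⇒¬pre v eq)) X≤k
    σ≤kt : σ ≤ k * t
    σ≤kt = begin
      σ                  ≤⟨ sumOn-mono-≤ free (λ v eq → forb-small v refl (free⇒¬pre v eq)) ⟩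
      sumOn free (const k) ≡⟨ sumOn-const free k ⟩
      t * k              ≡⟨ *-comm t k ⟩
      k * t              ∎
    3kt≤ : 3 * k * t ≤ σ + (count (pre D) + t) * t
    3kt≤ = begin
      3 * k * t                     ≤⟨ *-monoˡ-≤ t 3k≤m+1 ⟩
      (m + 1) * t                   ≤⟨ colours-on-unprecoloured free free⇒¬pre ⟩
      σ + n * t                     ≡⟨ cong (λ n → σ + n * t) (n≡count+count∁ (pre D)) ⟩
      σ + (count (pre D) + t) * t   ∎

  cheaper-side-light : ∀ {X : Fin n → Bool} {a b} → count X ≤ k → a ≤ b → a + b ≤ sum w → a + count X * k < 2 * (k * k)
  cheaper-side-light {X} {a} {b} X≤k a≤b a+b≤ = begin-strict
    a + count X * k   <⟨ +-mono-<-≤ a<kk (*-monoˡ-≤ k X≤k) ⟩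
    k * k + k * k     ≡⟨ cong (k * k +_) (+-identityʳ (k * k)) ⟨
    2 * (k * k)       ∎
    where
    open ≤-Reasoning
    a<kk : a < k * k
    a<kk = ≰⇒> λ kk≤a → <⇒≱ cheap (begin
      2 * (k * k)       ≡⟨ cong (k * k +_) (+-identityʳ (k * k)) ⟩
      k * k + k * k     ≤⟨ +-mono-≤ kk≤a (≤-trans kk≤a a≤b) ⟩
      a + b             ≤⟨ a+b≤ ⟩
      sum w             ∎)

  no-small-separation : 3 * k ≤ m + 1 → ∀ {X} → count X ≤ k → Separation G X → ⊥
  no-small-separation 3k≤m+1 {X} X≤k sep = by-cases (unprecoloured-in left) (unprecoloured-in right)
    where
    open Separation sep
    unprecoloured-in : ∀ V → Dec (∃ λ v → V v ≡ true × pre D v ≡ false)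
    unprecoloured-in V = any? λ v → (V v Bool.≟ true) ×-dec (pre D v Bool.≟ false)
    outside : ∀ V → ¬ (∃ λ v → V v ≡ true × pre D v ≡ false) → ∀ v → pre D v ≡ false → V v ≡ false
    outside V none v v∉pre = ¬-not λ v∈ → none (v , v∈ , v∉pre)
    inside : ∀ V → ¬ (∃ λ v → V v ≡ true × pre D v ≡ false) → ∀ v → V v ≡ true → pre D v ≡ true
    inside V none v v∈ = ¬-not λ v∉pre → none (v , v∈ , v∉pre)
    by-cases : Dec (∃ λ v → left v ≡ true × pre D v ≡ false) → Dec (∃ λ v → right v ≡ true × pre D v ≡ false) → ⊥
    by-cases (no ¬l) (no ¬r) = cut-covers-unprecoloured 3k≤m+1 X≤k
      λ v v∉pre → covers v (outside left ¬l v v∉pre) (outside right ¬r v v∉pre)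
    by-cases (no ¬l) (yes (q , q∈ , q∉pre)) = precoloured-side X≤k sep (inside left ¬l) q q∈ q∉pre
    by-cases (yes (p , p∈ , p∉pre)) (no ¬r) = precoloured-side X≤k swap (inside right ¬r) p p∈ p∉pre
    by-cases (yes (p , p∈ , p∉pre)) (yes (q , q∈ , q∉pre)) with sumOn left w ≤? sumOn right w
    ... | yes l≤r = cheap-side sep p p∈ p∉pre (cheaper-side-light X≤k l≤r (sumOn-disjoint left right w disjoint))
    ... | no  l≰r = cheap-side swap q q∈ q∉pre (cheaper-side-light X≤k (<⇒≤ (≰⇒> l≰r))
                      (subst (_≤ sum w) (+-comm (sumOn left w) _) (sumOn-disjoint left right w disjoint)))

lemma3p2 : (k m : ℕ) → 1 ≤ k → 3 * k ∸ 1 ≤ m →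
    ∀ n (G : Graph n) → MinimallyInextensible k m G →
    (m ∸ k + 1 < n) × Connected (k + 1) G
lemma3p2 k m 1≤k 3k∸1≤m n G ((T , cost< , forb≤k , uncolourable) , minimal) =
  order , ≤-<-trans (+-monoˡ-≤ 1 (m+n≤o⇒m≤o∸n k k+k≤m)) order , λ X ∣X∣<k+1 cut →
    cutset⇒¬¬separation cut (no-small-separation 3k≤m+1
      (subst (_≤ k) (∣p∣≡count X) (m<1+n⇒m≤n (subst (∣ X ∣ <_) (+-comm k 1) ∣X∣<k+1))))
  where
  open Critical (minimal⇒extensibleOnProperSubsets minimal) (demandsOf T)
                (demandsOf-admissible T cost< forb≤k) (¬respects⇒¬extendable T uncolourable)
  3k≤m+1 : 3 * k ≤ m + 1
  3k≤m+1 = m∸1≤n⇒m≤n+1 3k∸1≤m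
  k+k≤m : k + k ≤ m
  k+k≤m = 1≤k⇒3k≤m+1⇒2k≤m 1≤k 3k≤m+1
  order : m ∸ k + 1 < n
  order = order-bound (≤-trans (m≤m+n k k) k+k≤m) 3k≤m+1
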